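{- Let $b$ be an integer. If $G\in\mathscr{G}(1,b)$ and $\delta(G)=2$, then $1+\frac{b}{2}\le\Delta(G)\le b$. In particular, if $\Delta(G)=b$ then $G$ has a $2$-equitable partition $V(G)=C_1\cup C_2$ with parameters $(1,1;b,0)$, i.e. every vertex of $C_1$ has exactly one neighbour in $C_1$ and one in $C_2$, and every vertex of $C_2$ has exactly $b$ neighbours in $C_1$ and none in $C_2$.
   Context: Graphs are finite, simple and undirected; eigenvalues are those of the adjacency matrix. An eigenvalue of $G$ is main if it has an eigenvector with nonzero entry sum. For integers $a,b$, $\mathscr{G}(a,b)$ is the set of connected graphs with exactly two main eigenvalues satisfying $\sum_{u\in N(v)}d(u)=a\,d(v)+b$ for every vertex $v$. $\delta(G),\Delta(G)$ are the minimum and maximum degrees. -}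

module Defs where

open import Level using (Level; _⊔_) renaming (suc to lsuc)
open import Data.Bool using (Bool; true; false; if_then_else_)
open import Data.Nat as ℕ using (ℕ; zero; suc)
open import Data.Integer as ℤ using (ℤ; +_)
open import Data.Fin using (Fin; zero; suc)
open import Data.Product using (Σ; ∃; _×_; _,_)
open import Data.Sum using (_⊎_)
open import Relation.Nullary using (¬_)
open import Relation.Binary.PropositionalEquality using (_≡_)
open import Relation.Binary.Structures using (IsTotalOrder)
open import Algebra.Bundles using (CommutativeRing)

foldFin : ∀ {a} {A : Set a} → (A → A → A) → A → ∀ {n} → (Fin n → A) → A
foldFin _∙_ e {zero}  f = e
foldFin _∙_ e {suc n} f = f zero ∙ foldFin _∙_ e (λ i → f (suc i))

-- Stdlib has no real numbers; eigenvalues of the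
-- (integer, symmetric) adjacency matrix are real algebraic numbers, so we
-- work over an arbitrary real closed field (an ordered field in which
-- nonnegative elements have square roots and odd-degree polynomials have
-- roots); by Tarski's transfer principle this is the same as working in ℝ.

module _ {c ℓ} (R : CommutativeRing c ℓ) where
  open CommutativeRing R

  powR : Carrier → ℕ → Carrier
  powR x zero    = 1#
  powR x (suc k) = x * powR x k

  monicEval : ∀ m → (Fin m → Carrier) → Carrier → Carrier
  monicEval m a x = powR x m + foldFin _+_ 0# (λ i → a i * powR x (Data.Fin.toℕ i))

record RealClosedField c ℓ : Set (lsuc (c ⊔ ℓ)) where
  field
    commutativeRing : CommutativeRing c ℓ
  open CommutativeRing commutativeRing public
  field
    _≤_          : Carrier → Carrier → Set ℓ
    isTotalOrder : IsTotalOrder _≈_ _≤_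
    0≉1          : ¬ (0# ≈ 1#)
    inverse      : ∀ x → ¬ (x ≈ 0#) → ∃ λ y → x * y ≈ 1#
    +-monoˡ-≤    : ∀ {x y} z → x ≤ y → (x + z) ≤ (y + z)
    *-nonneg     : ∀ {x y} → 0# ≤ x → 0# ≤ y → 0# ≤ (x * y)
    sqrt         : ∀ x → 0# ≤ x → ∃ λ y → (y * y) ≈ x
    oddRoot      : ∀ k (a : Fin (suc (2 ℕ.* k)) → Carrier) →
                   ∃ λ x → monicEval commutativeRing (suc (2 ℕ.* k)) a x ≈ 0#

record Graph (n : ℕ) : Set where
  field
    adj     : Fin n → Fin n → Bool
    sym     : ∀ u v → adj u v ≡ adj v u
    irrefl  : ∀ v → adj v v ≡ false

module _ {n : ℕ} (G : Graph n) where
  open Graph G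

  deg : Fin n → ℕ
  deg v = foldFin ℕ._+_ 0 (λ u → if adj v u then 1 else 0)

  nbDegSum : Fin n → ℕ
  nbDegSum v = foldFin ℕ._+_ 0 (λ u → if adj v u then deg u else 0)

  degIn : (Fin n → Bool) → Fin n → ℕ
  degIn S v = foldFin ℕ._+_ 0 (λ u → if adj v u then (if S u then 1 else 0) else 0)

  -- Δ(G) (= 0 for the empty graph)
  maxDeg : ℕ
  maxDeg = foldFin ℕ._⊔_ 0 deg

  IsMinDeg : ℕ → Set
  IsMinDeg k = (∃ λ v → deg v ≡ k) × (∀ v → k ℕ.≤ deg v)

  data Reach : Fin n → Fin n → Set where
    here : ∀ {v} → Reach v v
    step : ∀ {u w v} → adj u w ≡ true → Reach w v → Reach u v

  Connected : Set
  Connected = ∀ u v → Reach u v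

  DegreeCondition : ℤ → ℤ → Set
  DegreeCondition a b = ∀ v → + nbDegSum v ≡ a ℤ.* + deg v ℤ.+ b

  module _ {c ℓ} (R : RealClosedField c ℓ) where
    open RealClosedField R

    adjMul : (Fin n → Carrier) → Fin n → Carrier
    adjMul x v = foldFin _+_ 0# (λ u → (if adj v u then 1# else 0#) * x u)

    entrySum : (Fin n → Carrier) → Carrier
    entrySum x = foldFin _+_ 0# x

    -- λ is a main eigenvalue: it has an eigenvector with nonzero entry sum
    -- (such a vector is automatically nonzero)
    IsMainEigenvalue : Carrier → Set (c ⊔ ℓ)
    IsMainEigenvalue λ' = ∃ λ (x : Fin n → Carrier) →
      (∀ v → adjMul x v ≈ λ' * x v) × ¬ (entrySum x ≈ 0#)

    TwoMainEigenvalues : Set (c ⊔ ℓ)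
    TwoMainEigenvalues = ∃ λ μ₁ → ∃ λ μ₂ → ¬ (μ₁ ≈ μ₂) ×
      IsMainEigenvalue μ₁ × IsMainEigenvalue μ₂ ×
      (∀ μ → IsMainEigenvalue μ → (μ ≈ μ₁) ⊎ (μ ≈ μ₂))

    InClass : ℤ → ℤ → Set (c ⊔ ℓ)
    InClass a b = Connected × TwoMainEigenvalues × DegreeCondition a b

  -- 2-equitable partition V = C₁ ∪ C₂ (C₁ = {v | S v ≡ true}) with
  -- parameters (1,1;b,0)
  EquitablePartition11b0 : ℤ → Set
  EquitablePartition11b0 b = ∃ λ (S : Fin n → Bool) →
    (∃ λ v → S v ≡ true) × (∃ λ v → S v ≡ false) ×
    (∀ v → S v ≡ true → degIn S v ≡ 1 × degIn (λ u → Data.Bool.not (S u)) v ≡ 1) ×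
    (∀ v → S v ≡ false → + degIn S v ≡ b × degIn (λ u → Data.Bool.not (S u)) v ≡ 0)

module Submission where

-- Lemma 4.5.  Let G ∈ 𝒢(1,b), so Σ_{u~v} d(u) = d(v) + b for every vertex v,
-- and let δ(G) = 2.  Since 2 ≤ d(u) ≤ Δ, the neighbour degree sum of v lies
-- between 2·d(v) and Δ·d(v).  At a vertex of degree 2 this gives 2 + b ≤ 2Δ,
-- at a vertex of degree Δ it gives 2Δ ≤ Δ + b, i.e. Δ ≤ b.
--
-- Now let Δ = b.  Write h(v) = d(v) − 2 for the excess of v and K = Δ − 2.
-- The degree condition becomes the balance equation h(v) + Σ_{u~v} h(u) = K.
-- If K = 0, G is 2-regular, and a regular graph has a single main eigenvalue,
-- contradicting membership in 𝒢(1,b).  If K > 0, balance forces the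
-- neighbours of a vertex of excess K (and the other neighbours of those) to
-- have excess 0; hence the property "v has excess K or a neighbour of excess
-- K" spreads along edges, and by connectivity every excess is 0 or K.  The
-- classes C₁ (excess 0) and C₂ (excess K) then have parameters (1,1;b,0).

open import Defs
open import Data.Nat using (ℕ; zero; suc)
open import Data.Fin using (Fin; zero; suc)
open import Data.Bool using (Bool; true; false; if_then_else_; not)
open import Data.Product using (∃; _×_; _,_)
open import Data.Sum using (_⊎_; inj₁; inj₂)
open import Data.Empty using (⊥-elim)
open import Data.Vec.Functional using (foldr)
open import Relation.Nullary using (¬_)
open import Relation.Binary.PropositionalEquality as ≡ using (_≡_)

-- Defs folds over Fin n directly; this is the library's Vector.foldr, so the
-- library's summation lemmas apply to the sums of Defs.
foldFin≡foldr : ∀ {a} {A : Set a} (_∙_ : A → A → A) (e : A) {n} (f : Fin n → A) →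
                foldFin _∙_ e f ≡ foldr _∙_ e f
foldFin≡foldr _∙_ e {zero}  f = ≡.refl
foldFin≡foldr _∙_ e {suc n} f = ≡.cong (f zero ∙_) (foldFin≡foldr _∙_ e (λ i → f (suc i)))

module Counting where
  open import Data.Nat using (_+_; _*_; _∸_; _⊔_; _≤_; _<_; z≤n; s≤s; _≡ᵇ_)
  open import Data.Nat.Properties hiding (_≟_)
  open import Data.Nat.Tactic.RingSolver using (solve-∀)
  open import Data.Fin.Properties using (_≟_)
  import Data.Integer as ℤ
  open import Relation.Nullary using (yes; no)
  open import Algebra.Properties.Semiring.Sum +-*-semiring
    using (sum; sum-cong-≗; ∑-distrib-+; *-distribˡ-sum)
  open ≡ using (refl; sym; trans; cong; subst)
  open ≤-Reasoning

  Σ : ∀ {n} → (Fin n → ℕ) → ℕ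
  Σ = foldFin _+_ 0

  Σ≡sum : ∀ {n} (f : Fin n → ℕ) → Σ f ≡ sum f
  Σ≡sum = foldFin≡foldr _+_ 0

  Σ-cong : ∀ {n} {f g : Fin n → ℕ} → (∀ i → f i ≡ g i) → Σ f ≡ Σ g
  Σ-cong {f = f} {g} f≗g = trans (Σ≡sum f) (trans (sum-cong-≗ f≗g) (sym (Σ≡sum g)))

  Σ-+ : ∀ {n} (f g : Fin n → ℕ) → Σ (λ i → f i + g i) ≡ Σ f + Σ g
  Σ-+ f g = trans (Σ≡sum (λ i → f i + g i)) (trans (∑-distrib-+ f g) (sym (≡.cong₂ _+_ (Σ≡sum f) (Σ≡sum g))))

  Σ-*ˡ : ∀ {n} c (f : Fin n → ℕ) → Σ (λ i → c * f i) ≡ c * Σ f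
  Σ-*ˡ c f = trans (Σ≡sum (λ i → c * f i)) (trans (sym (*-distribˡ-sum c f)) (cong (c *_) (sym (Σ≡sum f))))

  Σ-mono : ∀ {n} {f g : Fin n → ℕ} → (∀ i → f i ≤ g i) → Σ f ≤ Σ g
  Σ-mono {zero}  f≤g = z≤n
  Σ-mono {suc n} f≤g = +-mono-≤ (f≤g zero) (Σ-mono (λ i → f≤g (suc i)))

  term≤Σ : ∀ {n} (f : Fin n → ℕ) i → f i ≤ Σ f
  term≤Σ f zero    = m≤m+n _ _
  term≤Σ f (suc i) = ≤-trans (term≤Σ (λ j → f (suc j)) i) (m≤n+m _ _)

  two-terms≤Σ : ∀ {n} (f : Fin n → ℕ) {i j} → ¬ i ≡ j → f i + f j ≤ Σ f
  two-terms≤Σ f {zero}  {zero}  i≢j = ⊥-elim (i≢j refl)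
  two-terms≤Σ f {zero}  {suc j} _   = +-monoʳ-≤ (f zero) (term≤Σ (λ k → f (suc k)) j)
  two-terms≤Σ f {suc i} {zero}  _   =
    ≤-trans (≤-reflexive (+-comm (f (suc i)) (f zero))) (+-monoʳ-≤ (f zero) (term≤Σ (λ k → f (suc k)) i))
  two-terms≤Σ f {suc i} {suc j} i≢j =
    ≤-trans (two-terms≤Σ (λ k → f (suc k)) (λ i≡j → i≢j (cong suc i≡j))) (m≤n+m _ _)

  Σ≤term⇒others-zero : ∀ {n} (f : Fin n → ℕ) {i j} → Σ f ≤ f j → ¬ i ≡ j → f i ≡ 0
  Σ≤term⇒others-zero f {i} {j} Σ≤fj i≢j =
    n≤0⇒n≡0 (+-cancelʳ-≤ (f j) (f i) 0 (≤-trans (two-terms≤Σ f i≢j) Σ≤fj))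

  Σ-positive : ∀ {n} (f : Fin n → ℕ) → 0 < Σ f → ∃ λ i → 0 < f i
  Σ-positive {suc n} f pos with f zero in f₀≡
  ... | suc _ = zero , subst (0 <_) (sym f₀≡) (s≤s z≤n)
  ... | zero  = let (i , fi>0) = Σ-positive (λ j → f (suc j)) pos in suc i , fi>0

  max : ∀ {n} → (Fin n → ℕ) → ℕ
  max = foldFin _⊔_ 0

  term≤max : ∀ {n} (f : Fin n → ℕ) i → f i ≤ max f
  term≤max f zero    = m≤m⊔n _ _
  term≤max f (suc i) = ≤-trans (term≤max (λ j → f (suc j)) i) (m≤n⊔m _ _)

  max-attained : ∀ {n} (f : Fin n → ℕ) → 0 < max f → ∃ λ i → f i ≡ max f
  max-attained {suc n} f pos with ⊔-sel (f zero) (max (λ j → f (suc j)))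
  ... | inj₁ max≡f₀   = zero , sym max≡f₀
  ... | inj₂ max≡rest =
    let (i , fi≡) = max-attained (λ j → f (suc j)) (subst (0 <_) max≡rest pos)
    in suc i , trans fi≡ (sym max≡rest)

  module Neighbourhood {n} (G : Graph n) where
    open Graph G using (adj)

    onN : Fin n → (Fin n → ℕ) → Fin n → ℕ
    onN v f u = if adj v u then f u else 0

    -- Σ_{u ∈ N(v)} f(u).  Definitionally, deg G v = Σnb v (λ _ → 1),
    -- nbDegSum G v = Σnb v (deg G) and degIn G S v = Σnb v (indicator of S).
    Σnb : Fin n → (Fin n → ℕ) → ℕ
    Σnb v f = Σ (onN v f)

    onN-adj : ∀ {v u} (f : Fin n → ℕ) → adj v u ≡ true → onN v f u ≡ f u
    onN-adj f vu rewrite vu = refl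

    Σnb-cong : ∀ v {f g} → (∀ u → adj v u ≡ true → f u ≡ g u) → Σnb v f ≡ Σnb v g
    Σnb-cong v {f} {g} f≗g = Σ-cong pointwise
      where
      pointwise : ∀ u → onN v f u ≡ onN v g u
      pointwise u with adj v u in vu
      ... | true  = f≗g u vu
      ... | false = refl

    Σnb-mono : ∀ v {f g} → (∀ u → adj v u ≡ true → f u ≤ g u) → Σnb v f ≤ Σnb v g
    Σnb-mono v {f} {g} f≤g = Σ-mono pointwise
      where
      pointwise : ∀ u → onN v f u ≤ onN v g u
      pointwise u with adj v u in vu
      ... | true  = f≤g u vu
      ... | false = z≤n

    Σnb-+ : ∀ v (f g : Fin n → ℕ) → Σnb v (λ u → f u + g u) ≡ Σnb v f + Σnb v g
    Σnb-+ v f g = trans (Σ-cong pointwise) (Σ-+ (onN v f) (onN v g))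
      where
      pointwise : ∀ u → onN v (λ w → f w + g w) u ≡ onN v f u + onN v g u
      pointwise u with adj v u
      ... | true  = refl
      ... | false = refl

    Σnb-*ˡ : ∀ v c (f : Fin n → ℕ) → Σnb v (λ u → c * f u) ≡ c * Σnb v f
    Σnb-*ˡ v c f = trans (Σ-cong pointwise) (Σ-*ˡ c (onN v f))
      where
      pointwise : ∀ u → onN v (λ w → c * f w) u ≡ c * onN v f u
      pointwise u with adj v u
      ... | true  = refl
      ... | false = sym (*-zeroʳ c)

    Σnb-const : ∀ v c → Σnb v (λ _ → c) ≡ c * deg G v
    Σnb-const v c = trans (Σnb-cong v (λ u _ → sym (*-identityʳ c))) (Σnb-*ˡ v c (λ _ → 1))

    Σnb-term : ∀ {v u} (f : Fin n → ℕ) → adj v u ≡ true → f u ≤ Σnb v f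
    Σnb-term {v} {u} f vu = subst (_≤ Σnb v f) (onN-adj f vu) (term≤Σ (onN v f) u)

    Σnb-others : ∀ {v w u} (f : Fin n → ℕ) → adj v w ≡ true → Σnb v f ≤ f w →
                 adj v u ≡ true → ¬ u ≡ w → f u ≡ 0
    Σnb-others {v} f vw Σ≤fw vu u≢w =
      trans (sym (onN-adj f vu))
            (Σ≤term⇒others-zero (onN v f) (subst (Σnb v f ≤_) (sym (onN-adj f vw)) Σ≤fw) u≢w)

    Σnb-positive : ∀ v (f : Fin n → ℕ) → 0 < Σnb v f → ∃ λ u → adj v u ≡ true × 0 < f u
    Σnb-positive v f pos with Σ-positive (onN v f) pos
    ... | u , fu>0 with adj v u in vu
    ...   | true  = u , vu , fu>0
    ...   | false = ⊥-elim (<-irrefl refl fu>0)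

    deg≤maxDeg : ∀ v → deg G v ≤ maxDeg G
    deg≤maxDeg = term≤max (deg G)

    maxDeg-attained : ∀ v → 0 < deg G v → ∃ λ u → deg G u ≡ maxDeg G
    maxDeg-attained v pos = max-attained (deg G) (<-≤-trans pos (deg≤maxDeg v))

    nbDegSum≤ : ∀ v → nbDegSum G v ≤ maxDeg G * deg G v
    nbDegSum≤ v = ≤-trans (Σnb-mono v (λ u _ → deg≤maxDeg u)) (≤-reflexive (Σnb-const v (maxDeg G)))

    ≤nbDegSum : ∀ {m} → (∀ u → m ≤ deg G u) → ∀ v → m * deg G v ≤ nbDegSum G v
    ≤nbDegSum {m} m≤deg v = ≤-trans (≤-reflexive (sym (Σnb-const v m))) (Σnb-mono v (λ u _ → m≤deg u))

  module Balanced {n} (G : Graph n) (h : Fin n → ℕ) (K : ℕ)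
                  (deg≡ : ∀ v → deg G v ≡ h v + 2)
                  (condition : ∀ v → nbDegSum G v ≡ deg G v + (K + 2)) where
    open Graph G using (adj) renaming (sym to adj-sym)
    open Neighbourhood G

    balance : ∀ v → h v + Σnb v h ≡ K
    balance v = +-cancelʳ-≡ (h v + 4) _ _ (begin-equality
      (h v + Σnb v h) + (h v + 4)  ≡⟨ rearrangeˡ (h v) (Σnb v h) ⟩
      Σnb v h + 2 * (h v + 2)       ≡⟨ cong (λ d → Σnb v h + 2 * d) (sym (deg≡ v)) ⟩
      Σnb v h + 2 * deg G v         ≡⟨ sym nbDegSum-split ⟩
      nbDegSum G v                  ≡⟨ condition v ⟩
      deg G v + (K + 2)             ≡⟨ cong (_+ (K + 2)) (deg≡ v) ⟩
      (h v + 2) + (K + 2)           ≡⟨ rearrangeʳ (h v) K ⟩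
      K + (h v + 4)                 ∎)
      where
      nbDegSum-split : nbDegSum G v ≡ Σnb v h + 2 * deg G v
      nbDegSum-split = trans (Σnb-cong v (λ u _ → deg≡ u))
                             (trans (Σnb-+ v h (λ _ → 2)) (cong (Σnb v h +_) (Σnb-const v 2)))
      rearrangeˡ : ∀ x H → (x + H) + (x + 4) ≡ H + 2 * (x + 2)
      rearrangeˡ = solve-∀
      rearrangeʳ : ∀ x c → (x + 2) + (c + 2) ≡ c + (x + 4)
      rearrangeʳ = solve-∀

    excess≤K : ∀ v → h v ≤ K
    excess≤K v = subst (h v ≤_) (balance v) (m≤m+n (h v) (Σnb v h))

    -- A neighbour x of excess K uses up the whole balance of w: w itself and
    -- the other neighbours of w have excess 0.
    saturated⇒neighbour-zero : ∀ {w x} → adj w x ≡ true → h x ≡ K → h w ≡ 0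
    saturated⇒neighbour-zero {w} {x} wx hx≡K = n≤0⇒n≡0 (+-cancelʳ-≤ K (h w) 0 (begin
      h w + K         ≡⟨ cong (h w +_) (sym hx≡K) ⟩
      h w + h x       ≤⟨ +-monoʳ-≤ (h w) (Σnb-term h wx) ⟩
      h w + Σnb w h   ≡⟨ balance w ⟩
      K               ∎))

    saturated⇒co-neighbour-zero : ∀ {w x z} → adj w x ≡ true → h x ≡ K →
                                  adj w z ≡ true → ¬ z ≡ x → h z ≡ 0
    saturated⇒co-neighbour-zero {w} wx hx≡K =
      Σnb-others h wx (≤-trans (m≤n+m (Σnb w h) (h w)) (≤-reflexive (trans (balance w) (sym hx≡K))))

    deficit-sum : ∀ u → Σnb u (λ z → K ∸ h z) + Σnb u h ≡ K * deg G u
    deficit-sum u = trans (sym (Σnb-+ u _ h))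
                          (trans (Σnb-cong u (λ z _ → m∸n+n≡m (excess≤K z))) (Σnb-const u K))

    module Positive (k : ℕ) (K≡ : K ≡ suc k) where

      -- A vertex u of excess 0 (hence of degree 2) with a neighbour w of
      -- excess 0 has a neighbour of excess K: the deficits around u sum to K,
      -- all of which sits at w, so any neighbour of positive excess (one
      -- exists since the excesses around u sum to K > 0) has deficit 0.
      other-neighbour-saturated : ∀ {u w} → h u ≡ 0 → adj u w ≡ true → h w ≡ 0 →
                                  ∃ λ y → adj u y ≡ true × h y ≡ K
      other-neighbour-saturated {u} {w} hu≡0 uw hw≡0 =
        let (y , uy , hy>0) = Σnb-positive u h (subst (0 <_) (sym (trans Σh≡K K≡)) (s≤s z≤n))
        in y , uy , positive⇒saturated uy hy>0
        where
        Σh≡K : Σnb u h ≡ K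
        Σh≡K = trans (cong (_+ Σnb u h) (sym hu≡0)) (balance u)
        Σdeficit≡K : Σnb u (λ z → K ∸ h z) ≡ K
        Σdeficit≡K = +-cancelʳ-≡ K _ _ (begin-equality
          Σnb u (λ z → K ∸ h z) + K        ≡⟨ cong (Σnb u (λ z → K ∸ h z) +_) (sym Σh≡K) ⟩
          Σnb u (λ z → K ∸ h z) + Σnb u h  ≡⟨ deficit-sum u ⟩
          K * deg G u                       ≡⟨ cong (K *_) (trans (deg≡ u) (cong (_+ 2) hu≡0)) ⟩
          K * 2                             ≡⟨ *-comm K 2 ⟩
          K + (K + 0)                       ≡⟨ cong (K +_) (+-identityʳ K) ⟩
          K + K                             ∎)
        -- a neighbour of positive excess is not w, so its deficit is 0
        positive⇒saturated : ∀ {y} → adj u y ≡ true → 0 < h y → h y ≡ K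
        positive⇒saturated {y} uy hy>0 = ≤-antisym (excess≤K y) (m∸n≡0⇒m≤n deficit-y≡0)
          where
          y≢w : ¬ y ≡ w
          y≢w refl = <-irrefl (sym hw≡0) hy>0
          deficit-y≡0 : K ∸ h y ≡ 0
          deficit-y≡0 = Σnb-others (λ z → K ∸ h z) uw
                          (≤-reflexive (trans Σdeficit≡K (cong (K ∸_) (sym hw≡0)))) uy y≢w

      NearSaturated : Fin n → Set
      NearSaturated v = ∃ λ x → (x ≡ v ⊎ adj v x ≡ true) × h x ≡ K

      -- NearSaturated spreads along edges: for u ~ w ~ x with h(x) = K and
      -- u ≠ x, u and w have excess 0 and u has another, saturated neighbour.
      near-step : ∀ {u w} → adj u w ≡ true → NearSaturated w → NearSaturated u
      near-step uw (x , inj₁ refl , hx≡K) = x , inj₂ uw , hx≡K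
      near-step {u} {w} uw (x , inj₂ wx , hx≡K) with x ≟ u
      ... | yes refl = x , inj₁ refl , hx≡K
      ... | no x≢u   =
        let (y , uy , hy≡K) = other-neighbour-saturated hu≡0 uw (saturated⇒neighbour-zero wx hx≡K)
        in y , inj₂ uy , hy≡K
        where
        hu≡0 : h u ≡ 0
        hu≡0 = saturated⇒co-neighbour-zero wx hx≡K (trans (adj-sym w u) uw) (λ u≡x → x≢u (sym u≡x))

      reach⇒near : ∀ {u v₀} → h v₀ ≡ K → Reach G u v₀ → NearSaturated u
      reach⇒near {v₀ = v₀} hv₀≡K here = v₀ , inj₁ refl , hv₀≡K
      reach⇒near hv₀≡K (step uw reach) = near-step uw (reach⇒near hv₀≡K reach)

      excess-0-or-K : Connected G → ∀ {v₀} → h v₀ ≡ K → ∀ v → h v ≡ 0 ⊎ h v ≡ K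
      excess-0-or-K connected hv₀≡K v with reach⇒near hv₀≡K (connected v _)
      ... | x , inj₁ refl , hx≡K = inj₂ hx≡K
      ... | x , inj₂ vx , hx≡K   = inj₁ (saturated⇒neighbour-zero vx hx≡K)

      module TwoClasses (excess : ∀ v → h v ≡ 0 ⊎ h v ≡ K) where
        inC₁ : Fin n → Bool
        inC₁ v = h v ≡ᵇ 0

        inC₂ : Fin n → Bool
        inC₂ v = not (inC₁ v)

        inC₁⇒zero : ∀ v → inC₁ v ≡ true → h v ≡ 0
        inC₁⇒zero v v∈C₁ with excess v
        ... | inj₁ hv≡0 = hv≡0
        ... | inj₂ hv≡K rewrite hv≡K | K≡ with v∈C₁
        ...   | ()

        inC₂⇒K : ∀ v → inC₁ v ≡ false → h v ≡ K
        inC₂⇒K v v∉C₁ with excess v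
        ... | inj₂ hv≡K = hv≡K
        ... | inj₁ hv≡0 rewrite hv≡0 with v∉C₁
        ...   | ()

        degIn-split : ∀ v → degIn G inC₁ v + degIn G inC₂ v ≡ deg G v
        degIn-split v = trans (sym (Σnb-+ v _ _)) (Σnb-cong v (λ u _ → one-side (inC₁ u)))
          where
          one-side : ∀ b → (if b then 1 else 0) + (if not b then 1 else 0) ≡ 1
          one-side true  = refl
          one-side false = refl

        -- Excesses are K on C₂ and 0 on C₁, so they count C₂-neighbours.
        Σnb-excess : ∀ v → Σnb v h ≡ K * degIn G inC₂ v
        Σnb-excess v = trans (Σnb-cong v (λ u _ → excess-as-count u)) (Σnb-*ˡ v K _)
          where
          excess-as-count : ∀ u → h u ≡ K * (if inC₂ u then 1 else 0)
          excess-as-count u with excess u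
          ... | inj₁ hu≡0 rewrite hu≡0 = sym (*-zeroʳ K)
          ... | inj₂ hu≡K rewrite hu≡K | K≡ = sym (*-identityʳ (suc k))

        -- On C₁ the balance K = Σ h is K times the number of C₂-neighbours.
        C₁-degrees : ∀ v → inC₁ v ≡ true → degIn G inC₁ v ≡ 1 × degIn G inC₂ v ≡ 1
        C₁-degrees v v∈C₁ = inside , across
          where
          hv≡0 : h v ≡ 0
          hv≡0 = inC₁⇒zero v v∈C₁
          K·across≡K : K * degIn G inC₂ v ≡ K * 1
          K·across≡K = trans (sym (Σnb-excess v))
                             (trans (trans (cong (_+ Σnb v h) (sym hv≡0)) (balance v)) (sym (*-identityʳ K)))
          across : degIn G inC₂ v ≡ 1
          across = *-cancelˡ-≡ _ _ (suc k) (subst (λ m → m * degIn G inC₂ v ≡ m * 1) K≡ K·across≡K)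
          inside : degIn G inC₁ v ≡ 1
          inside = +-cancelʳ-≡ 1 _ _ (begin-equality
            degIn G inC₁ v + 1                 ≡⟨ cong (degIn G inC₁ v +_) (sym across) ⟩
            degIn G inC₁ v + degIn G inC₂ v    ≡⟨ degIn-split v ⟩
            deg G v                            ≡⟨ trans (deg≡ v) (cong (_+ 2) hv≡0) ⟩
            2                                  ∎)

        -- On C₂ the balance leaves Σ h = 0, so there are no C₂-neighbours.
        C₂-degrees : ∀ v → inC₁ v ≡ false → degIn G inC₁ v ≡ K + 2 × degIn G inC₂ v ≡ 0
        C₂-degrees v v∉C₁ = inside , across
          where
          hv≡K : h v ≡ K
          hv≡K = inC₂⇒K v v∉C₁
          Σh≡0 : Σnb v h ≡ 0
          Σh≡0 = +-cancelˡ-≡ K _ _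
                   (trans (cong (_+ Σnb v h) (sym hv≡K)) (trans (balance v) (sym (+-identityʳ K))))
          across : degIn G inC₂ v ≡ 0
          across with m*n≡0⇒m≡0∨n≡0 K (trans (sym (Σnb-excess v)) Σh≡0)
          ... | inj₂ across≡0 = across≡0
          ... | inj₁ K≡0 with trans (sym K≡0) K≡
          ...   | ()
          inside : degIn G inC₁ v ≡ K + 2
          inside = begin-equality
            degIn G inC₁ v                     ≡⟨ sym (+-identityʳ _) ⟩
            degIn G inC₁ v + 0                 ≡⟨ cong (degIn G inC₁ v +_) (sym across) ⟩
            degIn G inC₁ v + degIn G inC₂ v    ≡⟨ degIn-split v ⟩
            deg G v                            ≡⟨ trans (deg≡ v) (cong (_+ 2) hv≡K) ⟩
            K + 2                              ∎

      partition : Connected G → ∀ {v₁ v₀} → h v₁ ≡ 0 → h v₀ ≡ K →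
                  EquitablePartition11b0 G (ℤ.+ (K + 2))
      partition connected {v₁} {v₀} hv₁≡0 hv₀≡K =
        inC₁ , (v₁ , v₁∈C₁) , (v₀ , v₀∉C₁) , C₁-degrees ,
        λ v v∉C₁ → let (inside , across) = C₂-degrees v v∉C₁ in cong ℤ.+_ inside , across
        where
        open TwoClasses (excess-0-or-K connected hv₀≡K)
        v₁∈C₁ : inC₁ v₁ ≡ true
        v₁∈C₁ rewrite hv₁≡0 = refl
        v₀∉C₁ : inC₁ v₀ ≡ false
        v₀∉C₁ rewrite hv₀≡K | K≡ = refl

  two-regular-or-partition : ∀ {n} (G : Graph n) → Connected G → IsMinDeg G 2 →
    (∀ v → nbDegSum G v ≡ deg G v + maxDeg G) →
    (∀ v → deg G v ≡ 2) ⊎ EquitablePartition11b0 G (ℤ.+ maxDeg G)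
  two-regular-or-partition G connected ((v₂ , dv₂≡2) , δ≥2) condition = by-K K refl
    where
    open Neighbourhood G
    h : Fin _ → ℕ
    h v = deg G v ∸ 2
    K : ℕ
    K = maxDeg G ∸ 2
    K+2≡Δ : K + 2 ≡ maxDeg G
    K+2≡Δ = m∸n+n≡m (≤-trans (δ≥2 v₂) (deg≤maxDeg v₂))
    open Balanced G h K (λ v → sym (m∸n+n≡m (δ≥2 v)))
                        (λ v → trans (condition v) (cong (deg G v +_) (sym K+2≡Δ)))
    by-K : ∀ m → K ≡ m → (∀ v → deg G v ≡ 2) ⊎ EquitablePartition11b0 G (ℤ.+ maxDeg G)
    by-K zero    K≡0 = inj₁ λ v →
      ≤-antisym (≤-trans (deg≤maxDeg v) (≤-reflexive (trans (sym K+2≡Δ) (cong (_+ 2) K≡0)))) (δ≥2 v)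
    by-K (suc k) K≡ with maxDeg-attained v₂ (subst (0 <_) (sym dv₂≡2) (s≤s z≤n))
    ... | v₀ , dv₀≡Δ = inj₂ (subst (λ m → EquitablePartition11b0 G (ℤ.+ m)) K+2≡Δ
                               (Positive.partition k K≡ connected (cong (_∸ 2) dv₂≡2) (cong (_∸ 2) dv₀≡Δ)))

module Spectral {c ℓ} (R : RealClosedField c ℓ) where
  open RealClosedField R hiding (zero; _≤_)
  open import Algebra.Properties.Semiring.Sum semiring
    using (sum; sum-cong-≋; ∑-comm; *-distribˡ-sum; *-distribʳ-sum)
  open import Algebra.Properties.Monoid.Mult +-monoid using (×-homo-+) renaming (_×_ to _×ₘ_)
  open import Relation.Binary.Reasoning.Setoid setoid
  import Data.Nat as ℕ

  *-cancelʳ-nonzero : ∀ {x y s} → ¬ s ≈ 0# → x * s ≈ y * s → x ≈ y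
  *-cancelʳ-nonzero {x} {y} {s} s≉0 xs≈ys with inverse s s≉0
  ... | t , st≈1 = begin
    x            ≈⟨ sym (*-identityʳ x) ⟩
    x * 1#       ≈⟨ *-congˡ (sym st≈1) ⟩
    x * (s * t)  ≈⟨ sym (*-assoc x s t) ⟩
    (x * s) * t  ≈⟨ *-congʳ xs≈ys ⟩
    (y * s) * t  ≈⟨ *-assoc y s t ⟩
    y * (s * t)  ≈⟨ *-congˡ st≈1 ⟩
    y * 1#       ≈⟨ *-identityʳ y ⟩
    y            ∎

  ι : ℕ → Carrier
  ι m = m ×ₘ 1#

  ι-Σ : ∀ {m} (f : Fin m → ℕ) → ι (foldFin ℕ._+_ 0 f) ≈ sum (λ i → ι (f i))
  ι-Σ {zero}  f = refl
  ι-Σ {suc m} f = trans (×-homo-+ 1# (f zero) _) (+-congˡ (ι-Σ (λ i → f (suc i))))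

  ι-indicator : ∀ b → ι (if b then 1 else 0) ≈ (if b then 1# else 0#)
  ι-indicator true  = +-identityʳ 1#
  ι-indicator false = refl

  module _ {n} (G : Graph n) where
    open Graph G using (adj) renaming (sym to adj-sym)

    A : Fin n → Fin n → Carrier
    A v u = if adj v u then 1# else 0#

    -- Each column of A sums to the degree (A is symmetric).
    column-sum : ∀ u → sum (λ v → A v u) ≈ ι (deg G u)
    column-sum u = begin
      sum (λ v → A v u)                          ≈⟨ sum-cong-≋ entry ⟩
      sum (λ v → ι (if adj u v then 1 else 0))   ≈⟨ sym (ι-Σ (λ v → if adj u v then 1 else 0)) ⟩
      ι (deg G u)                                 ∎
      where
      entry : ∀ v → A v u ≈ ι (if adj u v then 1 else 0)
      entry v = trans (reflexive (≡.cong (λ b → if b then 1# else 0#) (adj-sym v u)))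
                      (sym (ι-indicator (adj u v)))

    -- In an r-regular graph 1ᵀAx = r·1ᵀx; for an eigenvector x with nonzero
    -- entry sum, 1ᵀAx = μ·1ᵀx then forces μ = r.
    regular⇒main-eigenvalue : ∀ r → (∀ v → deg G v ≡ r) →
                              ∀ μ → IsMainEigenvalue G R μ → μ ≈ ι r
    regular⇒main-eigenvalue r regular μ (x , eigen , Σx≉0) = *-cancelʳ-nonzero Σx≉0 (begin
      μ * entrySum G R x                          ≡⟨ ≡.cong (μ *_) (foldFin≡foldr _+_ 0# x) ⟩
      μ * sum x                                   ≈⟨ *-distribˡ-sum μ x ⟩
      sum (λ v → μ * x v)                         ≈⟨ sum-cong-≋ (λ v → sym (eigen v)) ⟩
      sum (adjMul G R x)                          ≈⟨ sum-cong-≋ (λ v → reflexive (foldFin≡foldr _+_ 0# (λ u → A v u * x u))) ⟩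
      sum (λ v → sum (λ u → A v u * x u))         ≈⟨ ∑-comm (λ v u → A v u * x u) ⟩
      sum (λ u → sum (λ v → A v u * x u))         ≈⟨ sum-cong-≋ (λ u → sym (*-distribʳ-sum (x u) (λ v → A v u))) ⟩
      sum (λ u → sum (λ v → A v u) * x u)         ≈⟨ sum-cong-≋ (λ u → *-congʳ (column-degree u)) ⟩
      sum (λ u → ι r * x u)                       ≈⟨ *-distribˡ-sum (ι r) x ⟨
      ι r * sum x                                 ≡⟨ ≡.cong (ι r *_) (foldFin≡foldr _+_ 0# x) ⟨
      ι r * entrySum G R x                        ∎)
      where
      column-degree : ∀ u → sum (λ v → A v u) ≈ ι r
      column-degree u = trans (column-sum u) (reflexive (≡.cong ι (regular u)))

    regular⇒¬two-main : ∀ r → (∀ v → deg G v ≡ r) → ¬ TwoMainEigenvalues G R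
    regular⇒¬two-main r regular (μ₁ , μ₂ , μ₁≉μ₂ , main₁ , main₂ , _) =
      μ₁≉μ₂ (trans (regular⇒main-eigenvalue r regular μ₁ main₁)
                   (sym (regular⇒main-eigenvalue r regular μ₂ main₂)))

open Counting using (module Neighbourhood; two-regular-or-partition)
open Spectral using (regular⇒¬two-main)
open import Data.Integer using (ℤ; +_; -_; _+_; _*_; _≤_)
open import Data.Integer.Base using (+≤+)
import Data.Integer.Properties as ℤP
import Data.Nat as ℕ
import Data.Nat.Properties as ℕP

+-cancelˡ-≤ : ∀ i {j k} → i + j ≤ i + k → j ≤ k
+-cancelˡ-≤ i {j} {k} i+j≤i+k = ≡.subst₂ _≤_ (undo j) (undo k) (ℤP.+-monoʳ-≤ (- i) i+j≤i+k)
  where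
  undo : ∀ x → - i + (i + x) ≡ x
  undo x = ≡.trans (≡.sym (ℤP.+-assoc (- i) i x))
                   (≡.trans (≡.cong (_+ x) (ℤP.+-inverseˡ i)) (ℤP.+-identityˡ x))

module _ {n} (G : Graph n) (b : ℤ) (condition : DegreeCondition G (+ 1) b) where
  open Neighbourhood G

  condition₁ : ∀ v → + nbDegSum G v ≡ + deg G v + b
  condition₁ v = ≡.trans (condition v) (≡.cong (_+ b) (ℤP.*-identityˡ (+ deg G v)))

  2+b≤2Δ : ∀ v → deg G v ≡ 2 → + 2 + b ≤ + 2 * + maxDeg G
  2+b≤2Δ v dv≡2 = begin
    + 2 + b                  ≡⟨ ≡.cong (λ d → + d + b) (≡.sym dv≡2) ⟩
    + deg G v + b            ≡⟨ ≡.sym (condition₁ v) ⟩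
    + nbDegSum G v           ≤⟨ +≤+ (nbDegSum≤ v) ⟩
    + (maxDeg G ℕ.* deg G v) ≡⟨ ≡.cong (λ d → + (maxDeg G ℕ.* d)) dv≡2 ⟩
    + (maxDeg G ℕ.* 2)       ≡⟨ ≡.cong +_ (ℕP.*-comm (maxDeg G) 2) ⟩
    + (2 ℕ.* maxDeg G)       ≡⟨ ℤP.pos-* 2 (maxDeg G) ⟩
    + 2 * + maxDeg G         ∎
    where open ℤP.≤-Reasoning

  Δ≤b : IsMinDeg G 2 → + maxDeg G ≤ b
  Δ≤b ((v₂ , dv₂≡2) , δ≥2) with maxDeg-attained v₂ (≡.subst (0 ℕ.<_) (≡.sym dv₂≡2) (ℕ.s≤s ℕ.z≤n))
  ... | v , dv≡Δ = +-cancelˡ-≤ (+ maxDeg G) (begin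
    + maxDeg G + + maxDeg G        ≡⟨ ℤP.pos-+ (maxDeg G) (maxDeg G) ⟨
    + (maxDeg G ℕ.+ maxDeg G)      ≡⟨ ≡.cong (λ d → + (d ℕ.+ d)) dv≡Δ ⟨
    + (deg G v ℕ.+ deg G v)        ≡⟨ ≡.cong (λ d → + (deg G v ℕ.+ d)) (ℕP.+-identityʳ (deg G v)) ⟨
    + (2 ℕ.* deg G v)              ≤⟨ +≤+ (≤nbDegSum δ≥2 v) ⟩
    + nbDegSum G v                 ≡⟨ condition₁ v ⟩
    + deg G v + b                  ≡⟨ ≡.cong (λ d → + d + b) dv≡Δ ⟩
    + maxDeg G + b                 ∎)
    where open ℤP.≤-Reasoning

  condition-Δ : + maxDeg G ≡ b → ∀ v → nbDegSum G v ≡ deg G v ℕ.+ maxDeg G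
  condition-Δ Δ≡b v = ℤP.+-injective (≡.trans (condition₁ v)
    (≡.trans (≡.cong (λ d → + deg G v + d) (≡.sym Δ≡b)) (≡.sym (ℤP.pos-+ (deg G v) (maxDeg G)))))

  -- If Δ = b the partition exists, since the alternative, a 2-regular graph,
  -- has only one main eigenvalue.
  equitable-if-Δ≡b : ∀ {c ℓ} (R : RealClosedField c ℓ) → Connected G → TwoMainEigenvalues G R →
                     IsMinDeg G 2 → + maxDeg G ≡ b → EquitablePartition11b0 G b
  equitable-if-Δ≡b R connected twoMain minDeg Δ≡b
    with two-regular-or-partition G connected minDeg (condition-Δ Δ≡b)
  ... | inj₁ two-regular = ⊥-elim (regular⇒¬two-main R G 2 two-regular twoMain)
  ... | inj₂ partition   = ≡.subst (EquitablePartition11b0 G) Δ≡b partition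

lemma4p5 : ∀ {c ℓ} (R : RealClosedField c ℓ) (b : ℤ) {n : ℕ} (G : Graph n) →
    InClass G R (+ 1) b → IsMinDeg G 2 →
    ((+ 2 + b ≤ + 2 * + maxDeg G) × (+ maxDeg G ≤ b)) ×
    (+ maxDeg G ≡ b → EquitablePartition11b0 G b)
lemma4p5 R b G (connected , twoMain , condition) minDeg@((v₂ , dv₂≡2) , _) =
  (2+b≤2Δ G b condition v₂ dv₂≡2 , Δ≤b G b condition minDeg) ,
  equitable-if-Δ≡b G b condition R connected twoMain minDeg
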